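{- In the category $\mathbf{Graph}$, not every PBPO$^+$ rule can be modeled by a set of AGREE rules, not every PBPO$^+$ rule can be modeled by a set of PBPO rules, and not every PBPO$^+$ rule can be modeled by a set of DPO rules. That is, for each $\mathcal{F}\in\{\mathrm{AGREE},\mathrm{PBPO},\mathrm{DPO}\}$ there is a PBPO$^+$ rule $\rho$ such that for no set $S$ of $\mathcal{F}$-rules does $\Rightarrow^{\rho}_{\mathrm{PBPO}^+}=\bigcup_{\tau\in S}\Rightarrow^{\tau}_{\mathcal{F}}$ hold.
   Context: $\mathbf{Graph}$ is the category whose objects are directed multigraphs $(V,E,s,t)$ labeled over a fixed label set (unlabeled if the label set is a singleton) and whose morphisms are label-preserving graph homomorphisms; it is a topos, so its regular monos are exactly its monos, and it has a mono-partial map classifier $(T,\eta)$ (for every span $A\xleftarrow{m}X\xrightarrow{f}B$ with $m$ mono there is a unique $[m,f]:A\to T(B)$ with $\eta_Bf=[m,f]m$ a pullback). PBPO$^+$: rule $l:K\to L$, $r:K\to R$, $t_L:L\to L'$, $t_K:K\to K'$, $l':K'\to L'$ with $t_Ll=l't_K$ a pullback; step with $m:L\to G_L$, $\alpha:G_L\to L'$: $\alpha m=t_L$ and $L\xleftarrow{1_L}L\xrightarrow{m}G_L$ a pullback of $t_L,\alpha$; $G_L\xleftarrow{g_L}G_K\xrightarrow{u'}K'$ a pullback of $\alpha,l'$; $u$ the unique morphism with $u'u=t_K$; $G_R$ a pushout of $G_K\xleftarrow{u}K\xrightarrow{r}R$. PBPO: rule is a commutative diagram of spans $L\xleftarrow{l}K\xrightarrow{r}R$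 over $L'\xleftarrow{l'}K'\xrightarrow{r'}R'$ via $t_L,t_K,t_R$; step with $m,\alpha$: $t_L=\alpha m$, $G_K$ the pullback of $\alpha,l'$, $u:K\to G_K$ induced, $G_R$ the pushout of $u,r$. AGREE (with $\mathcal{M}$ the monos): rule is a span $L\xleftarrow{l}K\xrightarrow{r}R$ with mono $t_K:K\to K'$; step with mono match $m$: $G_K$ the pullback of $G_L\xrightarrow{[m,1_L]}T(L)\xleftarrow{[t_K,l]}K'$, $u$ induced, $G_R$ the pushout of $u,r$. DPO: rule is a span $L\xleftarrow{l}K\xrightarrow{r}R$ with $l$ mono; a step with match $m$ is a diagram over $G_L\leftarrow G_K\to G_R$ in which both squares are pushouts. In each case $\Rightarrow^{\tau}$ is the union over all admissible matches (and adherences). -}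

module Defs where

open import Data.Product using (Σ; _×_; _,_)
open import Relation.Binary.PropositionalEquality using (_≡_; refl; trans; cong)
open import Relation.Nullary using (¬_)

record Graph (Λ : Set) : Set₁ where
  field
    V E : Set
    src tgt : E → V
    lV : V → Λ
    lE : E → Λ

record Hom {Λ : Set} (G H : Graph Λ) : Set where
  field
    hV : Graph.V G → Graph.V H
    hE : Graph.E G → Graph.E H
    src-pres : ∀ e → Graph.src H (hE e) ≡ hV (Graph.src G e)
    tgt-pres : ∀ e → Graph.tgt H (hE e) ≡ hV (Graph.tgt G e)
    lV-pres : ∀ v → Graph.lV H (hV v) ≡ Graph.lV G v
    lE-pres : ∀ e → Graph.lE H (hE e) ≡ Graph.lE G e

open Hom public

module _ {Λ : Set} where

  idH : {G : Graph Λ} → Hom G G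
  idH = record
    { hV = λ v → v ; hE = λ e → e
    ; src-pres = λ _ → refl ; tgt-pres = λ _ → refl
    ; lV-pres = λ _ → refl ; lE-pres = λ _ → refl }

  infixr 9 _∘H_
  _∘H_ : {A B C : Graph Λ} → Hom B C → Hom A B → Hom A C
  g ∘H f = record
    { hV = λ v → hV g (hV f v)
    ; hE = λ e → hE g (hE f e)
    ; src-pres = λ e → trans (src-pres g (hE f e)) (cong (hV g) (src-pres f e))
    ; tgt-pres = λ e → trans (tgt-pres g (hE f e)) (cong (hV g) (tgt-pres f e))
    ; lV-pres = λ v → trans (lV-pres g (hV f v)) (lV-pres f v)
    ; lE-pres = λ e → trans (lE-pres g (hE f e)) (lE-pres f e) }

  infix 4 _≈H_
  _≈H_ : {A B : Graph Λ} → Hom A B → Hom A B → Set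
  f ≈H g = (∀ v → hV f v ≡ hV g v) × (∀ e → hE f e ≡ hE g e)

  IsMono : {A B : Graph Λ} → Hom A B → Set₁
  IsMono {A} f = ∀ {X : Graph Λ} (a b : Hom X A) → f ∘H a ≈H f ∘H b → a ≈H b

  IsPullback : {A B C P : Graph Λ} → Hom A C → Hom B C → Hom P A → Hom P B → Set₁
  IsPullback {A} {B} {C} {P} f g p q =
    (f ∘H p ≈H g ∘H q) ×
    (∀ {X : Graph Λ} (a : Hom X A) (b : Hom X B) → f ∘H a ≈H g ∘H b →
      Σ (Hom X P) λ h → (p ∘H h ≈H a) × (q ∘H h ≈H b) ×
        (∀ (h' : Hom X P) → p ∘H h' ≈H a → q ∘H h' ≈H b → h' ≈H h))

  IsPushout : {A B C P : Graph Λ} → Hom A B → Hom A C → Hom B P → Hom C P → Set₁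
  IsPushout {A} {B} {C} {P} f g i j =
    (i ∘H f ≈H j ∘H g) ×
    (∀ {X : Graph Λ} (b : Hom B X) (c : Hom C X) → b ∘H f ≈H c ∘H g →
      Σ (Hom P X) λ h → (h ∘H i ≈H b) × (h ∘H j ≈H c) ×
        (∀ (h' : Hom P X) → h' ∘H i ≈H b → h' ∘H j ≈H c → h' ≈H h))

  IsPMC : {B TB : Graph Λ} → Hom B TB → Set₁
  IsPMC {B} {TB} η =
    ∀ {A X : Graph Λ} (m : Hom X A) (f : Hom X B) → IsMono m →
      Σ (Hom A TB) λ φ → IsPullback φ η m f ×
        (∀ (φ' : Hom A TB) → IsPullback φ' η m f → φ' ≈H φ)

  Rel : Set₂
  Rel = Graph Λ → Graph Λ → Set₁

  ⋃ : {Rule : Set₁} → (Rule → Rel) → (I : Set₁) → (I → Rule) → Rel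
  ⋃ step I S G H = Σ I λ i → step (S i) G H

  SameRel : Rel → Rel → Set₁
  SameRel R₁ R₂ = ∀ (G H : Graph Λ) → (R₁ G H → R₂ G H) × (R₂ G H → R₁ G H)

record PBPO⁺Rule (Λ : Set) : Set₁ where
  field
    L K R L' K' : Graph Λ
    l : Hom K L
    r : Hom K R
    tL : Hom L L'
    tK : Hom K K'
    l' : Hom K' L'
    pb : IsPullback tL l' l tK

PBPO⁺Step : {Λ : Set} → PBPO⁺Rule Λ → Graph Λ → Graph Λ → Set₁
PBPO⁺Step {Λ} ρ GL GR =
  Σ (Hom L GL) λ m → Σ (Hom GL L') λ α →
    (α ∘H m ≈H tL) × IsPullback tL α idH m ×
    Σ (Graph Λ) λ GK → Σ (Hom GK GL) λ gL → Σ (Hom GK K') λ u' →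
      IsPullback α l' gL u' ×
      Σ (Hom K GK) λ u → (u' ∘H u ≈H tK) ×
        Σ (Hom GK GR) λ gR → Σ (Hom R GR) λ w → IsPushout u r gR w
  where open PBPO⁺Rule ρ

record PBPORule (Λ : Set) : Set₁ where
  field
    L K R L' K' R' : Graph Λ
    l : Hom K L
    r : Hom K R
    l' : Hom K' L'
    r' : Hom K' R'
    tL : Hom L L'
    tK : Hom K K'
    tR : Hom R R'
    commL : tL ∘H l ≈H l' ∘H tK
    commR : tR ∘H r ≈H r' ∘H tK

PBPOStep : {Λ : Set} → PBPORule Λ → Graph Λ → Graph Λ → Set₁
PBPOStep {Λ} ρ GL GR =
  Σ (Hom L GL) λ m → Σ (Hom GL L') λ α →
    (tL ≈H α ∘H m) ×
    Σ (Graph Λ) λ GK → Σ (Hom GK GL) λ gL → Σ (Hom GK K') λ u' →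
      IsPullback α l' gL u' ×
      Σ (Hom K GK) λ u → (gL ∘H u ≈H m ∘H l) × (u' ∘H u ≈H tK) ×
        Σ (Hom GK GR) λ gR → Σ (Hom R GR) λ w → IsPushout u r gR w
  where open PBPORule ρ

-- AGREE (M = monos)

record AGREERule (Λ : Set) : Set₁ where
  field
    L K R K' : Graph Λ
    l : Hom K L
    r : Hom K R
    tK : Hom K K'
    tK-mono : IsMono tK

AGREEStep : {Λ : Set} → AGREERule Λ → Graph Λ → Graph Λ → Set₁
AGREEStep {Λ} ρ GL GR =
  Σ (Hom L GL) λ m → IsMono m ×
    Σ (Graph Λ) λ TL → Σ (Hom L TL) λ η → IsPMC η ×
    Σ (Hom GL TL) λ φm → IsPullback φm η m idH ×
    Σ (Hom K' TL) λ φt → IsPullback φt η tK l ×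
    Σ (Graph Λ) λ GK → Σ (Hom GK GL) λ gL → Σ (Hom GK K') λ u' →
      IsPullback φm φt gL u' ×
      Σ (Hom K GK) λ u → (gL ∘H u ≈H m ∘H l) × (u' ∘H u ≈H tK) ×
        Σ (Hom GK GR) λ gR → Σ (Hom R GR) λ w → IsPushout u r gR w
  where open AGREERule ρ

record DPORule (Λ : Set) : Set₁ where
  field
    L K R : Graph Λ
    l : Hom K L
    r : Hom K R
    l-mono : IsMono l

DPOStep : {Λ : Set} → DPORule Λ → Graph Λ → Graph Λ → Set₁
DPOStep {Λ} ρ GL GR =
  Σ (Hom L GL) λ m →
  Σ (Graph Λ) λ GK → Σ (Hom K GK) λ k → Σ (Hom GK GL) λ gL →
  Σ (Hom GK GR) λ gR → Σ (Hom R GR) λ m' →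
    IsPushout l k m gL × IsPushout r k m' gR
  where open DPORule ρ

NotModelable : {Λ : Set} {Rule : Set₁} → (Rule → Rel {Λ}) → Rel {Λ} → Set₂
NotModelable {Λ} {Rule} step R =
  ∀ (I : Set₁) (S : I → Rule) → ¬ SameRel R (⋃ step I S)

-- The counterexamples are rules `delete L` that erase a copy of L and fix its context to be empty:
-- the pullback condition on the adherence forces every source graph to be a retract of L. A rule of
-- another formalism that reproduces the step L ⇒ ∅ is then shown to also rewrite some graph which is
-- not a retract of L. For L = ∅, both sides of an applicable AGREE or DPO rule are empty; such a DPO
-- rule rewrites every graph to itself, and such an AGREE rule rewrites T(L), which is pointed-not-deletable since
-- it classifies the nowhere defined partial maps. For L a single vertex, a PBPO step to ∅ has an
-- empty interface, so it survives replacing the host graph by two vertices retracting onto it.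
module Submission where

open import Defs
open import Data.Product using (Σ; _×_; _,_; proj₁; proj₂)
open import Data.Empty using (⊥; ⊥-elim)
open import Data.Unit using (⊤; tt)
open import Data.Bool using (Bool; true; false)
open import Relation.Binary.PropositionalEquality using (refl; sym; trans; cong)
open import Relation.Nullary using (¬_)

module _ {Λ : Set} where

  ≈H-refl : {A B : Graph Λ} (f : Hom A B) → f ≈H f
  ≈H-refl f = (λ _ → refl) , (λ _ → refl)

  id-pullback : {B C : Graph Λ} (g : Hom B C) → IsPullback idH g g idH
  id-pullback g = ≈H-refl g ,
    λ a b (p , q) → b , ((λ v → sym (p v)) , (λ e → sym (q e))) , ≈H-refl b , λ _ _ r → r

  ∅ : Graph Λ
  ∅ = record { V = ⊥ ; E = ⊥ ; src = λ () ; tgt = λ () ; lV = λ () ; lE = λ () }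

  discrete : Set → Λ → Graph Λ
  discrete X x = record { V = X ; E = ⊥ ; src = λ () ; tgt = λ () ; lV = λ _ → x ; lE = λ () }

  discreteMap : {X Y : Set} {x : Λ} → (X → Y) → Hom (discrete X x) (discrete Y x)
  discreteMap f = record
    { hV = f ; hE = λ () ; src-pres = λ () ; tgt-pres = λ () ; lV-pres = λ _ → refl ; lE-pres = λ () }

  emptyHom : {A B : Graph Λ} → Hom A ∅ → Hom A B
  emptyHom z = record
    { hV = λ v → ⊥-elim (hV z v) ; hE = λ e → ⊥-elim (hE z e)
    ; src-pres = λ e → ⊥-elim (hE z e) ; tgt-pres = λ e → ⊥-elim (hE z e)
    ; lV-pres = λ v → ⊥-elim (hV z v) ; lE-pres = λ e → ⊥-elim (hE z e) }

  emptyHom-unique : {A B : Graph Λ} → Hom A ∅ → (f g : Hom A B) → f ≈H g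
  emptyHom-unique z f g = (λ v → ⊥-elim (hV z v)) , (λ e → ⊥-elim (hE z e))

  emptyHom-mono : {A B : Graph Λ} → Hom A ∅ → (f : Hom A B) → IsMono f
  emptyHom-mono z f a b _ = emptyHom-unique (z ∘H a) a b

  ¡ : {B : Graph Λ} → Hom ∅ B
  ¡ = emptyHom idH

  pushout-emptyˡ : {A B C : Graph Λ} (f : Hom A B) (g : Hom A C) (i : Hom B C) →
                   Hom B ∅ → IsPushout f g i idH
  pushout-emptyˡ f g i z =
    emptyHom-unique (z ∘H f) (i ∘H f) g ,
    λ b c _ → c , emptyHom-unique z (c ∘H i) b , ≈H-refl c , λ _ _ q → q

  pushout-emptyʳ : {A B C : Graph Λ} (f : Hom A B) (g : Hom A C) (j : Hom C B) →
                   Hom C ∅ → IsPushout f g idH j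
  pushout-emptyʳ f g j z =
    emptyHom-unique (z ∘H g) f (j ∘H g) ,
    λ b c _ → b , ≈H-refl b , emptyHom-unique z (b ∘H j) c , λ _ p _ → p

  pmc-weaklyTerminal : {B TB : Graph Λ} (η : Hom B TB) → IsPMC η → (A : Graph Λ) → Hom A TB
  pmc-weaklyTerminal η pmc A = proj₁ (pmc (¡ {A}) ¡ (emptyHom-mono idH (¡ {A})))

  notModelable : {Rule : Set₁} {step : Rule → Rel} {R : Rel} {G H : Graph Λ} → R G H →
    (∀ τ → step τ G H → Σ (Graph Λ) λ G' → Σ (Graph Λ) λ H' → step τ G' H' × ¬ R G' H') →
    NotModelable step R
  notModelable {G = G} {H} RGH transfer I S same with proj₁ (same G H) RGH
  ... | i , st with transfer (S i) st
  ... | G' , H' , st' , ¬RG'H' = ¬RG'H' (proj₂ (same G' H') (i , st'))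

  delete : Graph Λ → PBPO⁺Rule Λ
  delete G = record
    { L = G ; K = ∅ ; R = ∅ ; L' = G ; K' = ∅
    ; l = ¡ ; r = idH ; tL = idH ; tK = idH ; l' = ¡ ; pb = id-pullback ¡ }

  delete-step : (G : Graph Λ) → PBPO⁺Step (delete G) G ∅
  delete-step G =
    idH , idH , ≈H-refl (idH {G = G}) , id-pullback idH ,
    ∅ , ¡ , idH , id-pullback ¡ , idH , ≈H-refl (idH {G = ∅}) , idH , idH , pushout-emptyˡ idH idH idH idH

  delete-source-retract : {L G H : Graph Λ} → PBPO⁺Step (delete L) G H →
    Σ (Hom G L) λ h → Σ (Hom L G) λ m → m ∘H h ≈H idH
  delete-source-retract (m , α , _ , pb , _) with proj₂ pb α idH (≈H-refl α)
  ... | h , _ , m∘h≈id , _ = h , m , m∘h≈id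

  twoPoints-not-retract : {x : Λ} →
    ¬ (Σ (Hom (discrete Bool x) (discrete ⊤ x)) λ h → Σ (Hom (discrete ⊤ x) (discrete Bool x)) λ m →
         m ∘H h ≈H idH)
  -- h true and h false are both tt by η for ⊤, so m ∘H h cannot separate true from false.
  twoPoints-not-retract (h , m , m∘h≈id) with trans (sym (proj₁ m∘h≈id true)) (proj₁ m∘h≈id false)
  ... | ()

  DPO-identity-step : (τ : DPORule Λ) → Hom (DPORule.L τ) ∅ → Hom (DPORule.R τ) ∅ →
    (G : Graph Λ) → DPOStep τ G G
  DPO-identity-step τ zL zR G =
    m , G , k , idH , idH , m' , pushout-emptyˡ l k m zL , pushout-emptyˡ r k m' zR
    where
      open DPORule τ
      m : Hom L G
      m = emptyHom zL
      k : Hom K G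
      k = emptyHom (zL ∘H l)
      m' : Hom R G
      m' = emptyHom zR

  AGREE-step-from-classifier : (τ : AGREERule Λ) → let open AGREERule τ in
    Hom L ∅ → Hom R ∅ → {TL : Graph Λ} (η : Hom L TL) → IsPMC η →
    (φt : Hom K' TL) → IsPullback φt η tK l → AGREEStep τ TL K'
  AGREE-step-from-classifier τ zL zR {TL} η pmc φt pbt =
    η , emptyHom-mono zL η , TL , η , pmc , idH , id-pullback η , φt , pbt ,
    K' , φt , idH , id-pullback φt , tK , proj₁ pbt , ≈H-refl tK ,
    idH , emptyHom zR , pushout-emptyʳ tK r (emptyHom zR) zR
    where open AGREERule τ

  -- Since the interface of a PBPO step to ∅ is empty, the pullback condition holds vacuously.
  PBPO-step-retract : (τ : PBPORule Λ) {G G' : Graph Λ} (s : Hom G G') (c : Hom G' G) →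
    c ∘H s ≈H idH → PBPOStep τ G ∅ → PBPOStep τ G' ∅
  PBPO-step-retract τ s c c∘s≈id (m , α , tL≈α∘m , GK , gL , u' , pb , u , _ , u'∘u≈tK , gR , w , po) =
    s ∘H m , α ∘H c , tL≈α∘c∘s∘m , GK , s ∘H gL , u' , pb' ,
    u , emptyHom-unique (gR ∘H u) ((s ∘H gL) ∘H u) ((s ∘H m) ∘H l) , u'∘u≈tK , gR , w , po
    where
      open PBPORule τ
      tL≈α∘c∘s∘m : tL ≈H (α ∘H c) ∘H (s ∘H m)
      tL≈α∘c∘s∘m =
        (λ v → trans (proj₁ tL≈α∘m v) (cong (hV α) (sym (proj₁ c∘s≈id (hV m v))))) ,
        (λ e → trans (proj₂ tL≈α∘m e) (cong (hE α) (sym (proj₂ c∘s≈id (hE m e)))))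
      pb' : IsPullback (α ∘H c) l' (s ∘H gL) u'
      pb' = emptyHom-unique gR ((α ∘H c) ∘H (s ∘H gL)) (l' ∘H u') , λ a b eq →
        let (h , _ , u'∘h≈b , _) = proj₂ pb (c ∘H a) b eq
        in h , emptyHom-unique (gR ∘H h) ((s ∘H gL) ∘H h) a , u'∘h≈b ,
           λ h' _ _ → emptyHom-unique (gR ∘H h) h' h

proposition18 : (Λ : Set) → Λ →
    (Σ (PBPO⁺Rule Λ) λ ρ → NotModelable AGREEStep (PBPO⁺Step ρ)) ×
    (Σ (PBPO⁺Rule Λ) λ ρ → NotModelable PBPOStep (PBPO⁺Step ρ)) ×
    (Σ (PBPO⁺Rule Λ) λ ρ → NotModelable DPOStep (PBPO⁺Step ρ))
proposition18 Λ x =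
  (delete ∅ , notModelable (delete-step ∅) agree) ,
  (delete point , notModelable (delete-step point) pbpo) ,
  (delete ∅ , notModelable (delete-step ∅) dpo)
  where
    point : Graph Λ
    point = discrete ⊤ x

    Transfer : {Rule : Set₁} → (Rule → Rel) → PBPO⁺Rule Λ → Graph Λ → Set₁
    Transfer step ρ G = ∀ τ → step τ G ∅ →
      Σ (Graph Λ) λ G' → Σ (Graph Λ) λ H' → step τ G' H' × ¬ PBPO⁺Step ρ G' H'

    pointed-not-deletable : {G H : Graph Λ} → Hom point G → ¬ PBPO⁺Step (delete ∅) G H
    pointed-not-deletable p step = hV (proj₁ (delete-source-retract step)) (hV p tt)

    agree : Transfer AGREEStep (delete ∅) ∅
    agree τ (zL , _ , TL , η , pmc , _ , _ , φt , pbt , _ , _ , _ , _ , _ , _ , _ , _ , zR , _) =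
      TL , AGREERule.K' τ , AGREE-step-from-classifier τ zL zR η pmc φt pbt ,
      pointed-not-deletable (pmc-weaklyTerminal η pmc point)

    pbpo : Transfer PBPOStep (delete point) point
    pbpo τ st =
      discrete Bool x , ∅ ,
      PBPO-step-retract τ (discreteMap (λ _ → true)) (discreteMap (λ _ → tt)) ((λ _ → refl) , λ ()) st ,
      λ step → twoPoints-not-retract (delete-source-retract step)

    dpo : Transfer DPOStep (delete ∅) ∅
    dpo τ (zL , _ , _ , _ , _ , zR , _) = point , point , DPO-identity-step τ zL zR point , pointed-not-deletable idH
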